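{- (Alternation Theorem, one vs. all.) For every integer $\ell \ge 1$ there is a first-order $\tau_{\mathsf{ord}}$-sentence $\varphi_\ell$ in prenex form, with a quantifier prefix that strictly alternates between $\exists$ and $\forall$ and ends with $\forall$, consisting of $q^*(\ell)+2$ quantifiers (and so at most $\log(\ell)+4$ quantifiers), which is true in $L_\ell$ and false in $L_m$ for every $m \ge 1$ with $m \neq \ell$.
   Context: Let $\tau_{\mathsf{ord}} = \langle <; \mathsf{min}, \mathsf{max}\rangle$ with $<$ binary and $\mathsf{min},\mathsf{max}$ constants. For $m \ge 1$, $L_m$ denotes the linear order on $m+1$ elements with $\mathsf{min},\mathsf{max}$ interpreted as its first and last elements ($m$ is its length); these are all the linear orders considered. $\log$ is base 2. The functions $q^*_\forall, q^*_\exists:\mathbb{N}_{\ge1}\to\mathbb{N}$ (the number of rounds used by the paper's "closest-to-midpoint with alternation" Spoiler strategy for separating lengths $\le \ell$ from lengths $>\ell$, starting with a universal, resp. existential, move) satisfy and are determined by: $q^*_\forall(1)=1$, $q^*_\exists(1)=2$, $q^*_\forall(2)=2$; $q^*_\exists(2m)=q^*_\forall(m)+1$ and $q^*_\exists(2m+1)=q^*_\forall(m+1)+1$ for $m\ge1$; $q^*_\forall(2m)=q^*_\exists(m)+1$ for $m\ge2$; $q^*_\forall(2m+1)=q^*_\exists(m)+1$ for $m\ge1$. Finally $q^*(\ell)=\min(q^*_\forall(\ell),q^*_\exists(\ell))$. -}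

module Defs where

open import Data.Nat using (ℕ; zero; suc; _+_; ⌊_/2⌋; ⌈_/2⌉; _⊓_)
open import Data.Fin using (Fin; fromℕ) renaming (zero to fzero; _<_ to _<ᶠ_)
open import Data.Vec using (Vec; lookup; _∷_; [])
open import Data.List using (List; []; _∷_)
open import Data.Product using (Σ; _×_)
open import Data.Empty using (⊥)
open import Data.Unit using (⊤)
open import Relation.Nullary using (¬_)
open import Relation.Binary.PropositionalEquality using (_≡_; _≢_)

-- Defined with a fuel argument (fuel ℓ suffices, since each recursive
-- call strictly decreases the argument for ℓ ≥ 2).  The value at 0 is
-- irrelevant (set to 0).
--   q∀(1)=1, q∀(2)=2, q∀(ℓ)=q∃(⌊ℓ/2⌋)+1 for ℓ ≥ 3
--     (covers q∀(2m)=q∃(m)+1, m≥2, and q∀(2m+1)=q∃(m)+1, m≥1)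
--   q∃(1)=2, q∃(ℓ)=q∀(⌈ℓ/2⌉)+1 for ℓ ≥ 2
--     (covers q∃(2m)=q∀(m)+1 and q∃(2m+1)=q∀(m+1)+1, m≥1)

mutual
  qA-fuel : ℕ → ℕ → ℕ
  qA-fuel zero    _ = 0
  qA-fuel (suc f) 0 = 0
  qA-fuel (suc f) 1 = 1
  qA-fuel (suc f) 2 = 2
  qA-fuel (suc f) ℓ@(suc (suc (suc _))) = suc (qE-fuel f ⌊ ℓ /2⌋)

  qE-fuel : ℕ → ℕ → ℕ
  qE-fuel zero    _ = 0
  qE-fuel (suc f) 0 = 0
  qE-fuel (suc f) 1 = 2
  qE-fuel (suc f) ℓ@(suc (suc _)) = suc (qA-fuel f ⌈ ℓ /2⌉)

q*∀ : ℕ → ℕ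
q*∀ ℓ = qA-fuel ℓ ℓ

q*∃ : ℕ → ℕ
q*∃ ℓ = qE-fuel ℓ ℓ

q* : ℕ → ℕ
q* ℓ = q*∀ ℓ ⊓ q*∃ ℓ

-- First-order logic over τ_ord = ⟨ < ; min , max ⟩ (with equality),
-- variables as de Bruijn indices.

data Term (n : ℕ) : Set where
  var  : Fin n → Term n
  cmin : Term n
  cmax : Term n

data QF (n : ℕ) : Set where
  ⊤'   : QF n
  ⊥'   : QF n
  _<'_ : Term n → Term n → QF n
  _='_ : Term n → Term n → QF n
  ¬'_  : QF n → QF n
  _∧'_ : QF n → QF n → QF n
  _∨'_ : QF n → QF n → QF n

data Prenex (n : ℕ) : Set where
  matrix : QF n → Prenex n
  ∃'     : Prenex (suc n) → Prenex n
  ∀'     : Prenex (suc n) → Prenex n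

Sentence : Set
Sentence = Prenex 0

data Quant : Set where
  ∃q ∀q : Quant

prefix : ∀ {n} → Prenex n → List Quant
prefix (matrix _) = []
prefix (∃' φ) = ∃q ∷ prefix φ
prefix (∀' φ) = ∀q ∷ prefix φ

Alternating : List Quant → Set
Alternating [] = ⊤
Alternating (_ ∷ []) = ⊤
Alternating (q ∷ q' ∷ qs) = q ≢ q' × Alternating (q' ∷ qs)

EndsWith∀ : List Quant → Set
EndsWith∀ [] = ⊥
EndsWith∀ (q ∷ []) = q ≡ ∀q
EndsWith∀ (_ ∷ q' ∷ qs) = EndsWith∀ (q' ∷ qs)

-- The linear order L_m of length m: universe Fin (suc m) (m+1 elements),
-- < the usual order, min = first element, max = last element.

Env : ℕ → ℕ → Set
Env m n = Vec (Fin (suc m)) n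

⟦_⟧t : ∀ {m n} → Term n → Env m n → Fin (suc m)
⟦ var i ⟧t ρ = lookup ρ i
⟦ cmin ⟧t ρ = fzero
⟦_⟧t {m} cmax ρ = fromℕ m

SatQF : ∀ m {n} → QF n → Env m n → Set
SatQF m ⊤' ρ = ⊤
SatQF m ⊥' ρ = ⊥
SatQF m (s <' t) ρ = ⟦ s ⟧t ρ <ᶠ ⟦ t ⟧t ρ
SatQF m (s =' t) ρ = ⟦ s ⟧t ρ ≡ ⟦ t ⟧t ρ
SatQF m (¬' φ) ρ = ¬ SatQF m φ ρ
SatQF m (φ ∧' ψ) ρ = SatQF m φ ρ × SatQF m ψ ρ
SatQF m (φ ∨' ψ) ρ = SatQF m φ ρ Data.Sum.⊎ SatQF m ψ ρ
  where import Data.Sum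

Sat : ∀ m {n} → Prenex n → Env m n → Set
Sat m (matrix φ) ρ = SatQF m φ ρ
Sat m (∃' φ) ρ = Σ (Fin (suc m)) λ x → Sat m φ (x ∷ ρ)
Sat m (∀' φ) ρ = (x : Fin (suc m)) → Sat m φ (x ∷ ρ)

_⊨_ : ℕ → Sentence → Set
m ⊨ φ = Sat m φ []

-- Write d(a, b) ≤ ℓ for b ≤ a + ℓ.  For ℓ ≥ 1,
--   d(a, b) ≤ ℓ      iff  every x with a < x < b has 0 < d(a, x) ≤ ⌊(ℓ-1)/2⌋ or 0 < d(x, b) ≤ ⌈(ℓ-1)/2⌉,
--   0 < d(a, b) ≤ ℓ  iff  some y with a ≤ y < b has d(a, y) ≤ ⌊ℓ/2⌋ and d(y, b) ≤ ⌈ℓ/2⌉,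
-- so one quantifier halves the distance, ∀ and ∃ alternating.  The new point decides which of
-- the two halves can hold at all: the other one is constantly true or false, so both halves
-- share the remaining quantifier block and the formulas stay prenex with an alternating prefix.
-- For ℓ ≥ 3 write ℓ = P + Q + 1 with P = ⌊ℓ/2⌋, Q = ⌊(ℓ-1)/2⌋: the order has length ℓ iff every
-- x > min has d(min, x) > P exactly when d(x, max) ≤ Q.  That sentence spends two quantifiers
-- more than d(·,·) ≤ P needs, and counting quantifiers along the halving recursion reproduces
-- the recursion defining q*_∀ and q*_∃, which halves ℓ at each step, so q*(ℓ) ≤ log ℓ + 2.

{-# OPTIONS --safe #-}
module Submission where

open import Defs
open import Data.Nat
open import Data.Nat.Properties
open import Data.Nat.Logarithm using (⌊log₂_⌋; ⌊log₂⌋-mono-≤; ⌊log₂⌊n/2⌋⌋≡⌊log₂n⌋∸1)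
open import Data.Fin using (Fin; toℕ; fromℕ<; fromℕ) renaming (zero to fzero; suc to fsuc)
import Data.Fin.Properties as Fin
open import Data.Vec using (Vec; []; _∷_)
open import Data.List using (List; []; _∷_; length)
open import Data.Product using (Σ; _×_; _,_; proj₁; proj₂)
import Data.Product.Function.Dependent.Propositional as Σ
open import Data.Product.Function.NonDependent.Propositional using (_×-⇔_)
open import Data.Sum using (_⊎_; inj₁; inj₂)
open import Data.Sum.Function.Propositional using (_⊎-⇔_)
open import Data.Empty using (⊥; ⊥-elim)
open import Data.Unit using (⊤; tt)
open import Relation.Nullary using (¬_; Dec; yes; no)
open import Relation.Nullary.Decidable using (¬?; _×-dec_; _⊎-dec_)
open import Relation.Binary.Definitions using (tri<; tri≈; tri>)
open import Relation.Binary.PropositionalEquality using (_≡_; _≢_; refl; sym; trans; cong; cong₂; subst)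
open import Function.Bundles using (_⇔_; mk⇔; Equivalence)
open import Function.Related.Propositional using (equivalence; ≡⇒; module EquationalReasoning)
open import Function.Related.TypeIsomorphisms using (¬-cong-⇔)
import Function.Properties.Equivalence as ⇔

open Equivalence using (to; from)

∀-cong-⇔ : {I : Set} {A B : I → Set} → (∀ i → A i ⇔ B i) → ((i : I) → A i) ⇔ ((i : I) → B i)
∀-cong-⇔ A⇔B = mk⇔ (λ f i → to (A⇔B i) (f i)) (λ g i → from (A⇔B i) (g i))

Σ-×-const : {I : Set} {A B : I → Set} {C : Set} → (∀ i → B i ⇔ C) → (Σ I λ i → A i × B i) ⇔ (Σ I A × C)
Σ-×-const B⇔C = mk⇔ (λ (i , a , b) → (i , a) , to (B⇔C i) b) (λ ((i , a) , c) → i , a , from (B⇔C i) c)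

Σ-const-× : {I : Set} {A B : I → Set} {C : Set} → (∀ i → A i ⇔ C) → (Σ I λ i → A i × B i) ⇔ (C × Σ I B)
Σ-const-× A⇔C = mk⇔ (λ (i , a , b) → to (A⇔C i) a , (i , b)) (λ (c , (i , b)) → i , from (A⇔C i) c , b)

-- Arithmetic behind the halving steps

Covered : (ℓ₁ ℓ₂ A B X : ℕ) → Set
Covered ℓ₁ ℓ₂ A B X = ¬ (A < X × X < B) ⊎ (A < X × X ≤ A + ℓ₁) ⊎ (X < B × B ≤ X + ℓ₂)

Midpoint : (ℓ₁ ℓ₂ A B Y : ℕ) → Set
Midpoint ℓ₁ ℓ₂ A B Y = (¬ Y < A × Y < B) × (Y ≤ A + ℓ₁ × B ≤ Y + ℓ₂)

Threshold : (P Q m X : ℕ) → Set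
Threshold P Q m X = ¬ 0 < X ⊎ (¬ X ≤ P × m ≤ X + Q) ⊎ (X ≤ P × ¬ m ≤ X + Q)

≮⇔≤+0 : ∀ A B → (¬ A < B) ⇔ B ≤ A + 0
≮⇔≤+0 A B = mk⇔ (λ A≮B → subst (B ≤_) (sym (+-identityʳ A)) (≮⇒≥ A≮B))
                (λ B≤A+0 A<B → <⇒≱ A<B (subst (B ≤_) (+-identityʳ A) B≤A+0))

∀-Covered⇔≤ : ∀ {m A B} ℓ₁ ℓ₂ → B ≤ m → ((X : ℕ) → X ≤ m → Covered ℓ₁ ℓ₂ A B X) ⇔ B ≤ A + suc (ℓ₁ + ℓ₂)
∀-Covered⇔≤ {m} {A} {B} ℓ₁ ℓ₂ B≤m = mk⇔ necessary sufficient
  where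
  X₀+ℓ₂ : suc (A + ℓ₁) + ℓ₂ ≡ A + suc (ℓ₁ + ℓ₂)
  X₀+ℓ₂ = trans (cong suc (+-assoc A ℓ₁ ℓ₂)) (sym (+-suc A (ℓ₁ + ℓ₂)))

  X₀<B : ¬ B ≤ A + suc (ℓ₁ + ℓ₂) → suc (A + ℓ₁) < B
  X₀<B B≰ = ≤-<-trans (subst (suc (A + ℓ₁) ≤_) X₀+ℓ₂ (m≤m+n _ ℓ₂)) (≰⇒> B≰)

  necessary : ((X : ℕ) → X ≤ m → Covered ℓ₁ ℓ₂ A B X) → B ≤ A + suc (ℓ₁ + ℓ₂)
  necessary cover with B ≤? A + suc (ℓ₁ + ℓ₂)
  ... | yes B≤ = B≤
  ... | no B≰ with cover (suc (A + ℓ₁)) (≤-trans (<⇒≤ (X₀<B B≰)) B≤m)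
  ...   | inj₁ ¬between            = ⊥-elim (¬between (s≤s (m≤m+n A ℓ₁) , X₀<B B≰))
  ...   | inj₂ (inj₁ (_ , X₀≤A+ℓ₁)) = ⊥-elim (n≮n _ X₀≤A+ℓ₁)
  ...   | inj₂ (inj₂ (_ , B≤X₀+ℓ₂)) = ⊥-elim (B≰ (subst (B ≤_) X₀+ℓ₂ B≤X₀+ℓ₂))

  sufficient : B ≤ A + suc (ℓ₁ + ℓ₂) → (X : ℕ) → X ≤ m → Covered ℓ₁ ℓ₂ A B X
  sufficient B≤ X _ with A <? X | X <? B
  ... | no A≮X  | _       = inj₁ (λ between → A≮X (proj₁ between))
  ... | yes _   | no X≮B  = inj₁ (λ between → X≮B (proj₂ between))
  ... | yes A<X | yes X<B with X ≤? A + ℓ₁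
  ...   | yes X≤A+ℓ₁ = inj₂ (inj₁ (A<X , X≤A+ℓ₁))
  ...   | no X≰A+ℓ₁  = inj₂ (inj₂ (X<B , ≤-trans B≤ (subst (_≤ X + ℓ₂) X₀+ℓ₂ (+-monoˡ-≤ ℓ₂ (≰⇒> X≰A+ℓ₁)))))

∃-Midpoint⇔<×≤ : ∀ {m A B} ℓ₁ ℓ₂ → B ≤ m → 1 ≤ ℓ₂ →
  (Σ ℕ λ Y → Y ≤ m × Midpoint ℓ₁ ℓ₂ A B Y) ⇔ (A < B × B ≤ A + (ℓ₁ + ℓ₂))
∃-Midpoint⇔<×≤ {m} {A} {B} ℓ₁ ℓ₂ B≤m 1≤ℓ₂ = mk⇔ necessary sufficient
  where
  necessary : (Σ ℕ λ Y → Y ≤ m × Midpoint ℓ₁ ℓ₂ A B Y) → A < B × B ≤ A + (ℓ₁ + ℓ₂)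
  necessary (Y , _ , (Y≮A , Y<B) , (Y≤A+ℓ₁ , B≤Y+ℓ₂)) =
    ≤-<-trans (≮⇒≥ Y≮A) Y<B ,
    ≤-trans B≤Y+ℓ₂ (subst (Y + ℓ₂ ≤_) (+-assoc A ℓ₁ ℓ₂) (+-monoˡ-≤ ℓ₂ Y≤A+ℓ₁))

  sufficient : A < B × B ≤ A + (ℓ₁ + ℓ₂) → Σ ℕ λ Y → Y ≤ m × Midpoint ℓ₁ ℓ₂ A B Y
  sufficient (A<B , B≤) with B ≤? A + ℓ₂
  ... | yes B≤A+ℓ₂ = A , ≤-trans (<⇒≤ A<B) B≤m , (n≮n A , A<B) , (m≤m+n A ℓ₁ , B≤A+ℓ₂)
  ... | no B≰A+ℓ₂ = B ∸ ℓ₂ , ≤-trans (m∸n≤m B ℓ₂) B≤m , (Y≮A , Y<B) , (Y≤A+ℓ₁ , ≤-reflexive (sym Y+ℓ₂≡B))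
    where
    A+ℓ₂<B : A + ℓ₂ < B
    A+ℓ₂<B = ≰⇒> B≰A+ℓ₂
    Y+ℓ₂≡B : B ∸ ℓ₂ + ℓ₂ ≡ B
    Y+ℓ₂≡B = m∸n+n≡m (≤-trans (m≤n+m ℓ₂ A) (<⇒≤ A+ℓ₂<B))
    Y<B : B ∸ ℓ₂ < B
    Y<B = subst (B ∸ ℓ₂ <_) Y+ℓ₂≡B (subst (_≤ B ∸ ℓ₂ + ℓ₂) (+-comm (B ∸ ℓ₂) 1) (+-monoʳ-≤ (B ∸ ℓ₂) 1≤ℓ₂))
    Y≮A : ¬ B ∸ ℓ₂ < A
    Y≮A Y<A = n≮n B (subst (_< B) Y+ℓ₂≡B (≤-<-trans (+-monoˡ-≤ ℓ₂ (<⇒≤ Y<A)) A+ℓ₂<B))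
    Y≤A+ℓ₁ : B ∸ ℓ₂ ≤ A + ℓ₁
    Y≤A+ℓ₁ = +-cancelʳ-≤ ℓ₂ (B ∸ ℓ₂) (A + ℓ₁)
               (subst (_≤ A + ℓ₁ + ℓ₂) (sym Y+ℓ₂≡B) (subst (B ≤_) (sym (+-assoc A ℓ₁ ℓ₂)) B≤))

∀-Threshold⇔≡ : ∀ {m} P Q → 1 ≤ P → 1 ≤ m → ((X : ℕ) → X ≤ m → Threshold P Q m X) ⇔ m ≡ suc (P + Q)
∀-Threshold⇔≡ {m} P Q 1≤P 1≤m = mk⇔ necessary sufficient
  where
  m∸Q+Q≡m : ¬ m ≤ Q → m ∸ Q + Q ≡ m
  m∸Q+Q≡m m≰Q = m∸n+n≡m (<⇒≤ (≰⇒> m≰Q))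

  -- The point violating the threshold: P + 1 if m is too large, 1 or m ∸ Q if it is too small.
  necessary : ((X : ℕ) → X ≤ m → Threshold P Q m X) → m ≡ suc (P + Q)
  necessary split with <-cmp m (suc (P + Q))
  ... | tri≈ _ m≡ _ = m≡
  ... | tri> _ _ m> with split (suc P) (≤-trans (s≤s (m≤m+n P Q)) (<⇒≤ m>))
  ...   | inj₁ ¬0<X               = ⊥-elim (¬0<X z<s)
  ...   | inj₂ (inj₁ (_ , m≤X+Q)) = ⊥-elim (n≮n m (≤-<-trans m≤X+Q m>))
  ...   | inj₂ (inj₂ (X≤P , _))   = ⊥-elim (n≮n P X≤P)
  necessary split | tri< m< _ _ with m ≤? Q
  ...   | yes m≤Q with split 1 1≤m
  ...     | inj₁ ¬0<1             = ⊥-elim (¬0<1 z<s)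
  ...     | inj₂ (inj₁ (1≰P , _)) = ⊥-elim (1≰P 1≤P)
  ...     | inj₂ (inj₂ (_ , m≰))  = ⊥-elim (m≰ (≤-trans m≤Q (m≤n+m Q 1)))
  necessary split | tri< m< _ _ | no m≰Q with split (m ∸ Q) (m∸n≤m m Q)
  ...     | inj₁ ¬0<X             = ⊥-elim (¬0<X (m<n⇒0<n∸m (≰⇒> m≰Q)))
  ...     | inj₂ (inj₁ (X≰P , _)) =
    ⊥-elim (X≰P (+-cancelʳ-≤ Q (m ∸ Q) P (subst (_≤ P + Q) (sym (m∸Q+Q≡m m≰Q)) (s≤s⁻¹ m<))))
  ...     | inj₂ (inj₂ (_ , m≰))  = ⊥-elim (m≰ (≤-reflexive (sym (m∸Q+Q≡m m≰Q))))

  sufficient : m ≡ suc (P + Q) → (X : ℕ) → X ≤ m → Threshold P Q m X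
  sufficient refl X _ with X ≤? P
  ... | yes X≤P = inj₂ (inj₂ (X≤P , λ m≤X+Q → n≮n (P + Q) (≤-trans m≤X+Q (+-monoˡ-≤ Q X≤P))))
  ... | no X≰P  = inj₂ (inj₁ (X≰P , +-monoˡ-≤ Q (≰⇒> X≰P)))

-- Alternating quantifier blocks shared by several subformulas

-- `n ⊕ K` is `K + n` computed by recursion on K, one binder at a time, as `quantify` adds them.
_⊕_ : ℕ → ℕ → ℕ
n ⊕ zero  = n
n ⊕ suc K = suc n ⊕ K

dual : Quant → Quant
dual ∃q = ∀q
dual ∀q = ∃q

quantify : ∀ {n} → Quant → (K : ℕ) → QF (n ⊕ K) → Prenex n
quantify s  zero    M = matrix M
quantify ∃q (suc K) M = ∃' (quantify ∀q K M)
quantify ∀q (suc K) M = ∀' (quantify ∃q K M)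

alternation : Quant → ℕ → List Quant
alternation s zero    = []
alternation s (suc K) = s ∷ alternation (dual s) K

prefix-quantify : ∀ {n} s K (M : QF (n ⊕ K)) → prefix (quantify s K M) ≡ alternation s K
prefix-quantify s  zero    M = refl
prefix-quantify ∃q (suc K) M = cong (∃q ∷_) (prefix-quantify ∀q K M)
prefix-quantify ∀q (suc K) M = cong (∀q ∷_) (prefix-quantify ∃q K M)

alternation-Alternating : ∀ s K → Alternating (alternation s K)
alternation-Alternating s  zero          = tt
alternation-Alternating s  (suc zero)    = tt
alternation-Alternating ∃q (suc (suc K)) = (λ ()) , alternation-Alternating ∀q (suc K)
alternation-Alternating ∀q (suc (suc K)) = (λ ()) , alternation-Alternating ∃q (suc K)

length-alternation : ∀ s K → length (alternation s K) ≡ K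
length-alternation s zero    = refl
length-alternation s (suc K) = cong suc (length-alternation (dual s) K)

wk : ∀ {n} → Term n → Term (suc n)
wk (var i) = var (fsuc i)
wk cmin    = cmin
wk cmax    = cmax

wkⁿ : ∀ {n} K → Term n → Term (n ⊕ K)
wkⁿ zero    t = t
wkⁿ (suc K) t = wkⁿ K (wk t)

module _ {m : ℕ} where

  extend : ∀ {n K} → Vec (Fin (suc m)) K → Env m n → Env m (n ⊕ K)
  extend []       ρ = ρ
  extend (v ∷ vs) ρ = extend vs (v ∷ ρ)

  ⟦wk⟧ : ∀ {n} (t : Term n) (x : Fin (suc m)) (ρ : Env m n) → ⟦ wk t ⟧t (x ∷ ρ) ≡ ⟦ t ⟧t ρ
  ⟦wk⟧ (var i) x ρ = refl
  ⟦wk⟧ cmin    x ρ = refl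
  ⟦wk⟧ cmax    x ρ = refl

  ⟦wkⁿ⟧ : ∀ {n K} (t : Term n) (vs : Vec (Fin (suc m)) K) (ρ : Env m n) →
          ⟦ wkⁿ K t ⟧t (extend vs ρ) ≡ ⟦ t ⟧t ρ
  ⟦wkⁿ⟧ t []       ρ = refl
  ⟦wkⁿ⟧ t (v ∷ vs) ρ = trans (⟦wkⁿ⟧ (wk t) vs (v ∷ ρ)) (⟦wk⟧ t v ρ)

  satQF? : ∀ {n} (φ : QF n) (ρ : Env m n) → Dec (SatQF m φ ρ)
  satQF? ⊤'       ρ = yes tt
  satQF? ⊥'       ρ = no (λ ())
  satQF? (s <' t) ρ = ⟦ s ⟧t ρ Fin.<? ⟦ t ⟧t ρ
  satQF? (s =' t) ρ = ⟦ s ⟧t ρ Fin.≟ ⟦ t ⟧t ρ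
  satQF? (¬' φ)   ρ = ¬? (satQF? φ ρ)
  satQF? (φ ∧' ψ) ρ = satQF? φ ρ ×-dec satQF? ψ ρ
  satQF? (φ ∨' ψ) ρ = satQF? φ ρ ⊎-dec satQF? ψ ρ

  sat? : ∀ {n} (φ : Prenex n) (ρ : Env m n) → Dec (Sat m φ ρ)
  sat? (matrix φ) ρ = satQF? φ ρ
  sat? (∃' φ)     ρ = Fin.any? (λ x → sat? φ (x ∷ ρ))
  sat? (∀' φ)     ρ = Fin.all? (λ x → sat? φ (x ∷ ρ))

  AlwaysTrue AlwaysFalse Constant : ∀ {n} K → QF (n ⊕ K) → Env m n → Set
  AlwaysTrue  K M ρ = (vs : Vec (Fin (suc m)) K) → SatQF m M (extend vs ρ)
  AlwaysFalse K M ρ = (vs : Vec (Fin (suc m)) K) → ¬ SatQF m M (extend vs ρ)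
  Constant    K M ρ = AlwaysTrue K M ρ ⊎ AlwaysFalse K M ρ

  alwaysTrue⇒sat : ∀ {n} s K (M : QF (n ⊕ K)) (ρ : Env m n) → AlwaysTrue K M ρ → Sat m (quantify s K M) ρ
  alwaysTrue⇒sat s  zero    M ρ true = true []
  alwaysTrue⇒sat ∃q (suc K) M ρ true = fzero , alwaysTrue⇒sat ∀q K M (fzero ∷ ρ) (λ vs → true (fzero ∷ vs))
  alwaysTrue⇒sat ∀q (suc K) M ρ true = λ x → alwaysTrue⇒sat ∃q K M (x ∷ ρ) (λ vs → true (x ∷ vs))

  alwaysFalse⇒¬sat : ∀ {n} s K (M : QF (n ⊕ K)) (ρ : Env m n) → AlwaysFalse K M ρ → ¬ Sat m (quantify s K M) ρ
  alwaysFalse⇒¬sat s  zero    M ρ false S       = false [] S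
  alwaysFalse⇒¬sat ∃q (suc K) M ρ false (x , S) = alwaysFalse⇒¬sat ∀q K M (x ∷ ρ) (λ vs → false (x ∷ vs)) S
  alwaysFalse⇒¬sat ∀q (suc K) M ρ false S       =
    alwaysFalse⇒¬sat ∃q K M (fzero ∷ ρ) (λ vs → false (fzero ∷ vs)) (S fzero)

  quantify-mono : ∀ {n} s K (M N : QF (n ⊕ K)) (ρ : Env m n) →
    ((vs : Vec (Fin (suc m)) K) → SatQF m M (extend vs ρ) → SatQF m N (extend vs ρ)) →
    Sat m (quantify s K M) ρ → Sat m (quantify s K N) ρ
  quantify-mono s  zero    M N ρ M⇒N S       = M⇒N [] S
  quantify-mono ∃q (suc K) M N ρ M⇒N (x , S) = x , quantify-mono ∀q K M N (x ∷ ρ) (λ vs → M⇒N (x ∷ vs)) S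
  quantify-mono ∀q (suc K) M N ρ M⇒N S       = λ x → quantify-mono ∃q K M N (x ∷ ρ) (λ vs → M⇒N (x ∷ vs)) (S x)

  quantify-∧ : ∀ {n} s K (M N : QF (n ⊕ K)) (ρ : Env m n) → Constant K M ρ ⊎ Constant K N ρ →
    Sat m (quantify s K (M ∧' N)) ρ ⇔ (Sat m (quantify s K M) ρ × Sat m (quantify s K N) ρ)
  quantify-∧ s K M N ρ constant = mk⇔
    (λ S → quantify-mono s K _ _ ρ (λ _ → proj₁) S , quantify-mono s K _ _ ρ (λ _ → proj₂) S)
    (pair constant)
    where
    pair : Constant K M ρ ⊎ Constant K N ρ → Sat m (quantify s K M) ρ × Sat m (quantify s K N) ρ →
           Sat m (quantify s K (M ∧' N)) ρ
    pair (inj₁ (inj₁ M-true))  (_ , SN) = quantify-mono s K _ _ ρ (λ vs → M-true vs ,_) SN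
    pair (inj₁ (inj₂ M-false)) (SM , _) = ⊥-elim (alwaysFalse⇒¬sat s K M ρ M-false SM)
    pair (inj₂ (inj₁ N-true))  (SM , _) = quantify-mono s K _ _ ρ (λ vs → _, N-true vs) SM
    pair (inj₂ (inj₂ N-false)) (_ , SN) = ⊥-elim (alwaysFalse⇒¬sat s K N ρ N-false SN)

  quantify-∨ : ∀ {n} s K (M N : QF (n ⊕ K)) (ρ : Env m n) → Constant K M ρ ⊎ Constant K N ρ →
    Sat m (quantify s K (M ∨' N)) ρ ⇔ (Sat m (quantify s K M) ρ ⊎ Sat m (quantify s K N) ρ)
  quantify-∨ s K M N ρ constant = mk⇔ (split constant) join
    where
    join : Sat m (quantify s K M) ρ ⊎ Sat m (quantify s K N) ρ → Sat m (quantify s K (M ∨' N)) ρ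
    join (inj₁ SM) = quantify-mono s K _ _ ρ (λ _ → inj₁) SM
    join (inj₂ SN) = quantify-mono s K _ _ ρ (λ _ → inj₂) SN
    split : Constant K M ρ ⊎ Constant K N ρ → Sat m (quantify s K (M ∨' N)) ρ →
            Sat m (quantify s K M) ρ ⊎ Sat m (quantify s K N) ρ
    split (inj₁ (inj₁ M-true))  _ = inj₁ (alwaysTrue⇒sat s K M ρ M-true)
    split (inj₁ (inj₂ M-false)) S = inj₂ (quantify-mono s K _ _ ρ
      (λ vs → λ { (inj₁ sM) → ⊥-elim (M-false vs sM) ; (inj₂ sN) → sN }) S)
    split (inj₂ (inj₁ N-true))  _ = inj₂ (alwaysTrue⇒sat s K N ρ N-true)
    split (inj₂ (inj₂ N-false)) S = inj₁ (quantify-mono s K _ _ ρ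
      (λ vs → λ { (inj₁ sM) → sM ; (inj₂ sN) → ⊥-elim (N-false vs sN) }) S)

  quantify∀-∧ : ∀ {n} K (M N : QF (n ⊕ suc K)) (ρ : Env m n) →
    ((x : Fin (suc m)) → Constant K M (x ∷ ρ) ⊎ Constant K N (x ∷ ρ)) →
    Sat m (quantify ∀q (suc K) (M ∧' N)) ρ ⇔ (Sat m (quantify ∀q (suc K) M) ρ × Sat m (quantify ∀q (suc K) N) ρ)
  quantify∀-∧ K M N ρ constant = mk⇔
    (λ S → (λ x → proj₁ (to (at x) (S x))) , (λ x → proj₂ (to (at x) (S x))))
    (λ (SM , SN) x → from (at x) (SM x , SN x))
    where at = λ x → quantify-∧ ∃q K M N (x ∷ ρ) (constant x)

  quantify∃-∨ : ∀ {n} K (M N : QF (n ⊕ suc K)) (ρ : Env m n) →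
    ((x : Fin (suc m)) → Constant K M (x ∷ ρ) ⊎ Constant K N (x ∷ ρ)) →
    Sat m (quantify ∃q (suc K) (M ∨' N)) ρ ⇔ (Sat m (quantify ∃q (suc K) M) ρ ⊎ Sat m (quantify ∃q (suc K) N) ρ)
  quantify∃-∨ K M N ρ constant = mk⇔ split join
    where
    at = λ x → quantify-∨ ∀q K M N (x ∷ ρ) (constant x)
    split : Sat m (quantify ∃q (suc K) (M ∨' N)) ρ →
            Sat m (quantify ∃q (suc K) M) ρ ⊎ Sat m (quantify ∃q (suc K) N) ρ
    split (x , S) with to (at x) S
    ... | inj₁ SM = inj₁ (x , SM)
    ... | inj₂ SN = inj₂ (x , SN)
    join : Sat m (quantify ∃q (suc K) M) ρ ⊎ Sat m (quantify ∃q (suc K) N) ρ →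
           Sat m (quantify ∃q (suc K) (M ∨' N)) ρ
    join (inj₁ (x , SM)) = x , from (at x) (inj₁ SM)
    join (inj₂ (x , SN)) = x , from (at x) (inj₂ SN)

  quantify-¬ : ∀ {n} s K (M : QF (n ⊕ K)) (ρ : Env m n) →
    Sat m (quantify (dual s) K (¬' M)) ρ ⇔ (¬ Sat m (quantify s K M) ρ)
  quantify-¬ s  zero    M ρ = ⇔.refl
  quantify-¬ ∃q (suc K) M ρ = mk⇔
    (λ S (x , T) → to (quantify-¬ ∀q K M (x ∷ ρ)) (S x) T)
    (λ ¬S x → from (quantify-¬ ∀q K M (x ∷ ρ)) (λ T → ¬S (x , T)))
  quantify-¬ ∀q (suc K) M ρ = mk⇔
    (λ (x , S) T → to (quantify-¬ ∃q K M (x ∷ ρ)) S (T x))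
    (λ ¬S → let (x , ¬Sx) = Fin.¬∀⟶∃¬ (suc m) _ (λ x → sat? (quantify ∃q K M) (x ∷ ρ)) ¬S
            in x , from (quantify-¬ ∃q K M (x ∷ ρ)) ¬Sx)

  Expresses : ∀ {n} K → QF (n ⊕ K) → Env m n → Set → Set
  Expresses K M ρ P = (vs : Vec (Fin (suc m)) K) → SatQF m M (extend vs ρ) ⇔ P

  expresses⇒constant : ∀ {n} K (M : QF (n ⊕ K)) (ρ : Env m n) {P} → Dec P → Expresses K M ρ P → Constant K M ρ
  expresses⇒constant K M ρ (yes p) M⇔P = inj₁ (λ vs → from (M⇔P vs) p)
  expresses⇒constant K M ρ (no ¬p) M⇔P = inj₂ (λ vs sM → ¬p (to (M⇔P vs) sM))

  expresses⇒sat : ∀ {n} s K (M : QF (n ⊕ K)) (ρ : Env m n) {P} → Dec P → Expresses K M ρ P →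
    Sat m (quantify s K M) ρ ⇔ P
  expresses⇒sat s K M ρ (yes p) M⇔P = mk⇔ (λ _ → p) (λ _ → alwaysTrue⇒sat s K M ρ (λ vs → from (M⇔P vs) p))
  expresses⇒sat s K M ρ (no ¬p) M⇔P = mk⇔
    (λ S → ⊥-elim (alwaysFalse⇒¬sat s K M ρ (λ vs sM → ¬p (to (M⇔P vs) sM)) S)) (λ p → ⊥-elim (¬p p))

  guard-∧ : ∀ {n} s K (G M : QF (n ⊕ K)) (ρ : Env m n) {P} → Dec P → Expresses K G ρ P →
    Sat m (quantify s K (G ∧' M)) ρ ⇔ (P × Sat m (quantify s K M) ρ)
  guard-∧ s K G M ρ P? G⇔P =
    ⇔.trans (quantify-∧ s K G M ρ (inj₁ (expresses⇒constant K G ρ P? G⇔P)))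
            (expresses⇒sat s K G ρ P? G⇔P ×-⇔ ⇔.refl)

  guard-∨ : ∀ {n} s K (G M : QF (n ⊕ K)) (ρ : Env m n) {P} → Dec P → Expresses K G ρ P →
    Sat m (quantify s K (G ∨' M)) ρ ⇔ (P ⊎ Sat m (quantify s K M) ρ)
  guard-∨ s K G M ρ P? G⇔P =
    ⇔.trans (quantify-∨ s K G M ρ (inj₁ (expresses⇒constant K G ρ P? G⇔P)))
            (expresses⇒sat s K G ρ P? G⇔P ⊎-⇔ ⇔.refl)

-- Distance formulas

_<[_]_ : ∀ {n} → Term n → (K : ℕ) → Term n → QF (n ⊕ K)
s <[ K ] t = wkⁿ K s <' wkⁿ K t

-- Read under an alternating block of K quantifiers, `dist≤ ℓ K a b` (block starting with ∀)
-- says b ≤ a + ℓ and `0<dist≤ ℓ K a b` (block starting with ∃) says a < b ≤ a + ℓ.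
mutual
  dist≤ : ℕ → (K : ℕ) → ∀ {n} → Term n → Term n → QF (n ⊕ K)
  dist≤ zero    K       a b = ¬' (a <[ K ] b)
  dist≤ (suc ℓ) zero    a b = ⊥'
  dist≤ (suc ℓ) (suc K) a b =
    (¬' ((wk a <[ K ] var fzero) ∧' (var fzero <[ K ] wk b)))
    ∨' (0<dist≤ ⌊ ℓ /2⌋ K (wk a) (var fzero) ∨' 0<dist≤ ⌈ ℓ /2⌉ K (var fzero) (wk b))

  0<dist≤ : ℕ → (K : ℕ) → ∀ {n} → Term n → Term n → QF (n ⊕ K)
  0<dist≤ zero    K       a b = ⊥'
  0<dist≤ (suc ℓ) zero    a b = ⊥'
  0<dist≤ (suc ℓ) (suc K) a b =
    ((¬' (var fzero <[ K ] wk a)) ∧' (var fzero <[ K ] wk b))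
    ∧' (dist≤ ⌊ suc ℓ /2⌋ K (wk a) (var fzero) ∧' dist≤ ⌈ suc ℓ /2⌉ K (var fzero) (wk b))

mutual
  Enough∀ : ℕ → ℕ → Set
  Enough∀ zero    K       = ⊤
  Enough∀ (suc ℓ) zero    = ⊥
  Enough∀ (suc ℓ) (suc K) = Enough∃ ⌊ ℓ /2⌋ K × Enough∃ ⌈ ℓ /2⌉ K

  Enough∃ : ℕ → ℕ → Set
  Enough∃ zero    K       = ⊤
  Enough∃ (suc ℓ) zero    = ⊥
  Enough∃ (suc ℓ) (suc K) = Enough∀ ⌊ suc ℓ /2⌋ K × Enough∀ ⌈ suc ℓ /2⌉ K

module _ {m : ℕ} where

  val : ∀ {n} → Term n → Env m n → ℕ
  val t ρ = toℕ (⟦ t ⟧t ρ)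

  val-wk : ∀ {n} (t : Term n) (x : Fin (suc m)) (ρ : Env m n) → val (wk t) (x ∷ ρ) ≡ val t ρ
  val-wk t x ρ = cong toℕ (⟦wk⟧ t x ρ)

  val≤m : ∀ {n} (t : Term n) (ρ : Env m n) → val t ρ ≤ m
  val≤m t ρ = Fin.toℕ≤pred[n] (⟦ t ⟧t ρ)

  ∀-Fin⇔∀≤ : {P : ℕ → Set} → ((x : Fin (suc m)) → P (toℕ x)) ⇔ ((X : ℕ) → X ≤ m → P X)
  ∀-Fin⇔∀≤ {P} = mk⇔
    (λ h X X≤m → subst P (Fin.toℕ-fromℕ< (s≤s X≤m)) (h (fromℕ< (s≤s X≤m))))
    (λ h x → h (toℕ x) (Fin.toℕ≤pred[n] x))

  ∃-Fin⇔∃≤ : {P : ℕ → Set} → (Σ (Fin (suc m)) λ x → P (toℕ x)) ⇔ (Σ ℕ λ X → X ≤ m × P X)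
  ∃-Fin⇔∃≤ {P} = mk⇔
    (λ (x , p) → toℕ x , Fin.toℕ≤pred[n] x , p)
    (λ (X , X≤m , p) → fromℕ< (s≤s X≤m) , subst P (sym (Fin.toℕ-fromℕ< (s≤s X≤m))) p)

  <-expresses : ∀ {n} K (s t : Term n) (ρ : Env m n) → Expresses K (s <[ K ] t) ρ (val s ρ < val t ρ)
  <-expresses K s t ρ vs = ≡⇒ (cong₂ (λ u v → toℕ u < toℕ v) (⟦wkⁿ⟧ s vs ρ) (⟦wkⁿ⟧ t vs ρ))

  between-expresses : ∀ {n} K (a b : Term n) (z : Fin (suc m)) (ρ : Env m n) →
    Expresses K ((wk a <[ K ] var fzero) ∧' (var fzero <[ K ] wk b)) (z ∷ ρ)
              (val a ρ < toℕ z × toℕ z < val b ρ)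
  between-expresses K a b z ρ vs =
    ⇔.trans (<-expresses K (wk a) (var fzero) (z ∷ ρ) vs ×-⇔ <-expresses K (var fzero) (wk b) (z ∷ ρ) vs)
            (≡⇒ (cong₂ (λ A B → A < toℕ z × toℕ z < B) (val-wk a z ρ) (val-wk b z ρ)))

  halfOpen-expresses : ∀ {n} K (a b : Term n) (z : Fin (suc m)) (ρ : Env m n) →
    Expresses K ((¬' (var fzero <[ K ] wk a)) ∧' (var fzero <[ K ] wk b)) (z ∷ ρ)
              (¬ toℕ z < val a ρ × toℕ z < val b ρ)
  halfOpen-expresses K a b z ρ vs =
    ⇔.trans (¬-cong-⇔ (<-expresses K (var fzero) (wk a) (z ∷ ρ) vs)
               ×-⇔ <-expresses K (var fzero) (wk b) (z ∷ ρ) vs)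
            (≡⇒ (cong₂ (λ A B → ¬ toℕ z < A × toℕ z < B) (val-wk a z ρ) (val-wk b z ρ)))

  dist≤-true-outside : ∀ ℓ K {n} (a b : Term n) (ρ : Env m n) (z : Fin (suc m)) →
    ¬ (val a ρ < toℕ z × toℕ z < val b ρ) → AlwaysTrue K (dist≤ (suc ℓ) (suc K) a b) (z ∷ ρ)
  dist≤-true-outside ℓ K a b ρ z z∉ vs = inj₁ (λ between → z∉ (to (between-expresses K a b z ρ vs) between))

  dist≤-constant-outside : ∀ ℓ K {n} (a b : Term n) (ρ : Env m n) (z : Fin (suc m)) →
    ¬ (val a ρ < toℕ z × toℕ z < val b ρ) → Constant K (dist≤ ℓ (suc K) a b) (z ∷ ρ)
  dist≤-constant-outside zero    K a b ρ z _   =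
    expresses⇒constant K (dist≤ 0 (suc K) a b) (z ∷ ρ) (¬? (val a ρ <? val b ρ))
      (λ vs → ¬-cong-⇔ (<-expresses (suc K) a b ρ (z ∷ vs)))
  dist≤-constant-outside (suc ℓ) K a b ρ z z∉ = inj₁ (dist≤-true-outside ℓ K a b ρ z z∉)

  0<dist≤-false-outside : ∀ ℓ K {n} (a b : Term n) (ρ : Env m n) (z : Fin (suc m)) →
    ¬ (¬ toℕ z < val a ρ × toℕ z < val b ρ) → AlwaysFalse K (0<dist≤ ℓ (suc K) a b) (z ∷ ρ)
  0<dist≤-false-outside zero    K a b ρ z z∉ vs ()
  0<dist≤-false-outside (suc ℓ) K a b ρ z z∉ vs (inside , _) =
    z∉ (to (halfOpen-expresses K a b z ρ vs) inside)

  -- Once a point u strictly between a and b is fixed, each half of `dist≤` asks the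
  -- next point z to lie in [a, u) or in [u, b).
  dist≤-false-after-split : ∀ ℓ K {n} (a b : Term n) (ρ : Env m n) (u z : Fin (suc m)) →
    val a ρ < toℕ u × toℕ u < val b ρ → ¬ (¬ toℕ z < val a ρ × toℕ z < val b ρ) →
    AlwaysFalse K (dist≤ (suc ℓ) (suc (suc K)) a b) (z ∷ u ∷ ρ)
  dist≤-false-after-split ℓ K a b ρ u z (a<u , u<b) z∉ vs (inj₁ ¬between) =
    ¬between (from (between-expresses (suc K) a b u ρ (z ∷ vs)) (a<u , u<b))
  dist≤-false-after-split ℓ K a b ρ u z (a<u , u<b) z∉ vs (inj₂ (inj₁ left)) =
    0<dist≤-false-outside ⌊ ℓ /2⌋ K (wk a) (var fzero) (u ∷ ρ) z
      (λ (z≮a , z<u) → z∉ (subst (λ A → ¬ toℕ z < A) (val-wk a u ρ) z≮a , <-trans z<u u<b)) vs left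
  dist≤-false-after-split ℓ K a b ρ u z (a<u , u<b) z∉ vs (inj₂ (inj₂ right)) =
    0<dist≤-false-outside ⌈ ℓ /2⌉ K (var fzero) (wk b) (u ∷ ρ) z
      (λ (z≮u , z<b) → z∉ ((λ z<a → z≮u (<-trans z<a a<u)) , subst (toℕ z <_) (val-wk b u ρ) z<b)) vs right

  0<dist≤-∨ : ∀ ℓ₁ ℓ₂ K {n} (a c b : Term n) (ρ : Env m n) →
    Sat m (quantify ∃q K (0<dist≤ ℓ₁ K a c ∨' 0<dist≤ ℓ₂ K c b)) ρ
    ⇔ (Sat m (quantify ∃q K (0<dist≤ ℓ₁ K a c)) ρ ⊎ Sat m (quantify ∃q K (0<dist≤ ℓ₂ K c b)) ρ)
  0<dist≤-∨ ℓ₁ ℓ₂ zero    a c b ρ = ⇔.refl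
  0<dist≤-∨ ℓ₁ ℓ₂ (suc K) a c b ρ = quantify∃-∨ K _ _ ρ oneFalse
    where
    oneFalse : (y : Fin (suc m)) →
      Constant K (0<dist≤ ℓ₁ (suc K) a c) (y ∷ ρ) ⊎ Constant K (0<dist≤ ℓ₂ (suc K) c b) (y ∷ ρ)
    oneFalse y with ¬? (toℕ y <? val a ρ) ×-dec (toℕ y <? val c ρ)
    ... | yes (_ , y<c) = inj₂ (inj₂ (0<dist≤-false-outside ℓ₂ K c b ρ y (λ (y≮c , _) → y≮c y<c)))
    ... | no ¬a≤y<c    = inj₁ (inj₂ (0<dist≤-false-outside ℓ₁ K a c ρ y ¬a≤y<c))

  dist≤-∧ : ∀ ℓ₁ ℓ₂ K {n} (a c b : Term n) (ρ : Env m n) →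
    Sat m (quantify ∀q K (dist≤ ℓ₁ K a c ∧' dist≤ ℓ₂ K c b)) ρ
    ⇔ (Sat m (quantify ∀q K (dist≤ ℓ₁ K a c)) ρ × Sat m (quantify ∀q K (dist≤ ℓ₂ K c b)) ρ)
  dist≤-∧ ℓ₁ ℓ₂ zero    a c b ρ = ⇔.refl
  dist≤-∧ ℓ₁ ℓ₂ (suc K) a c b ρ = quantify∀-∧ K _ _ ρ oneConstant
    where
    oneConstant : (z : Fin (suc m)) →
      Constant K (dist≤ ℓ₁ (suc K) a c) (z ∷ ρ) ⊎ Constant K (dist≤ ℓ₂ (suc K) c b) (z ∷ ρ)
    oneConstant z with (val a ρ <? toℕ z) ×-dec (toℕ z <? val c ρ)
    ... | yes (_ , z<c) = inj₂ (dist≤-constant-outside ℓ₂ K c b ρ z (λ (c<z , _) → <-asym z<c c<z))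
    ... | no ¬a<z<c    = inj₁ (dist≤-constant-outside ℓ₁ K a c ρ z ¬a<z<c)

  mutual
    dist≤-sat : ∀ ℓ K → Enough∀ ℓ K → ∀ {n} (a b : Term n) (ρ : Env m n) →
      Sat m (quantify ∀q K (dist≤ ℓ K a b)) ρ ⇔ val b ρ ≤ val a ρ + ℓ
    dist≤-sat zero K _ a b ρ =
      expresses⇒sat ∀q K (dist≤ 0 K a b) ρ (val b ρ ≤? val a ρ + 0)
        (λ vs → ⇔.trans (¬-cong-⇔ (<-expresses K a b ρ vs)) (≮⇔≤+0 (val a ρ) (val b ρ)))
    dist≤-sat (suc ℓ) (suc K) (enough₁ , enough₂) a b ρ = begin
      ((x : Fin (suc m)) → Sat m (quantify ∃q K (dist≤ (suc ℓ) (suc K) a b)) (x ∷ ρ))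
        ∼⟨ ∀-cong-⇔ (dist≤-sat-at ℓ K enough₁ enough₂ a b ρ) ⟩
      ((x : Fin (suc m)) → Covered ⌊ ℓ /2⌋ ⌈ ℓ /2⌉ A B (toℕ x))
        ∼⟨ ∀-Fin⇔∀≤ ⟩
      ((X : ℕ) → X ≤ m → Covered ⌊ ℓ /2⌋ ⌈ ℓ /2⌉ A B X)
        ∼⟨ ∀-Covered⇔≤ ⌊ ℓ /2⌋ ⌈ ℓ /2⌉ (val≤m b ρ) ⟩
      B ≤ A + suc (⌊ ℓ /2⌋ + ⌈ ℓ /2⌉)
        ≡⟨ cong (λ k → B ≤ A + suc k) (⌊n/2⌋+⌈n/2⌉≡n ℓ) ⟩
      B ≤ A + suc ℓ ∎
      where
      open EquationalReasoning {k = equivalence}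
      A = val a ρ
      B = val b ρ

    dist≤-sat-at : ∀ ℓ K → Enough∃ ⌊ ℓ /2⌋ K → Enough∃ ⌈ ℓ /2⌉ K →
      ∀ {n} (a b : Term n) (ρ : Env m n) (x : Fin (suc m)) →
      Sat m (quantify ∃q K (dist≤ (suc ℓ) (suc K) a b)) (x ∷ ρ) ⇔ Covered ⌊ ℓ /2⌋ ⌈ ℓ /2⌉ (val a ρ) (val b ρ) (toℕ x)
    dist≤-sat-at ℓ K enough₁ enough₂ a b ρ x = begin
      Sat∃ (dist≤ (suc ℓ) (suc K) a b)
        ∼⟨ guard-∨ ∃q K _ _ (x ∷ ρ) (¬? ((A <? X) ×-dec (X <? B)))
                   (λ vs → ¬-cong-⇔ (between-expresses K a b x ρ vs)) ⟩
      (¬ (A < X × X < B) ⊎ Sat∃ (0<dist≤ ℓ₁ K (wk a) x′ ∨' 0<dist≤ ℓ₂ K x′ (wk b)))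
        ∼⟨ ⇔.refl ⊎-⇔ 0<dist≤-∨ ℓ₁ ℓ₂ K (wk a) x′ (wk b) (x ∷ ρ) ⟩
      (¬ (A < X × X < B) ⊎ Sat∃ (0<dist≤ ℓ₁ K (wk a) x′) ⊎ Sat∃ (0<dist≤ ℓ₂ K x′ (wk b)))
        ∼⟨ ⇔.refl ⊎-⇔ (0<dist≤-sat ℓ₁ K enough₁ (wk a) x′ (x ∷ ρ)
                       ⊎-⇔ 0<dist≤-sat ℓ₂ K enough₂ x′ (wk b) (x ∷ ρ)) ⟩
      (¬ (A < X × X < B) ⊎ (A′ < X × X ≤ A′ + ℓ₁) ⊎ (X < B′ × B′ ≤ X + ℓ₂))
        ≡⟨ cong₂ (λ A′ B′ → ¬ (A < X × X < B) ⊎ (A′ < X × X ≤ A′ + ℓ₁) ⊎ (X < B′ × B′ ≤ X + ℓ₂))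
                 (val-wk a x ρ) (val-wk b x ρ) ⟩
      Covered ℓ₁ ℓ₂ A B X ∎
      where
      open EquationalReasoning {k = equivalence}
      ℓ₁ = ⌊ ℓ /2⌋
      ℓ₂ = ⌈ ℓ /2⌉
      A = val a ρ
      B = val b ρ
      X = toℕ x
      x′ = var fzero
      A′ = val (wk a) (x ∷ ρ)
      B′ = val (wk b) (x ∷ ρ)
      Sat∃ : QF (suc _ ⊕ K) → Set
      Sat∃ M = Sat m (quantify ∃q K M) (x ∷ ρ)

    0<dist≤-sat : ∀ ℓ K → Enough∃ ℓ K → ∀ {n} (a b : Term n) (ρ : Env m n) →
      Sat m (quantify ∃q K (0<dist≤ ℓ K a b)) ρ ⇔ (val a ρ < val b ρ × val b ρ ≤ val a ρ + ℓ)
    0<dist≤-sat zero K _ a b ρ =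
      expresses⇒sat ∃q K (0<dist≤ 0 K a b) ρ (no empty) (λ vs → mk⇔ (λ ()) (λ inside → ⊥-elim (empty inside)))
      where
      empty : ¬ (val a ρ < val b ρ × val b ρ ≤ val a ρ + 0)
      empty (A<B , B≤A+0) = from (≮⇔≤+0 (val a ρ) (val b ρ)) B≤A+0 A<B
    0<dist≤-sat (suc ℓ) (suc K) (enough₁ , enough₂) a b ρ = begin
      (Σ (Fin (suc m)) λ y → Sat m (quantify ∀q K (0<dist≤ (suc ℓ) (suc K) a b)) (y ∷ ρ))
        ∼⟨ Σ.congˡ (λ {y} → 0<dist≤-sat-at ℓ K enough₁ enough₂ a b ρ y) ⟩
      (Σ (Fin (suc m)) λ y → Midpoint ⌊ suc ℓ /2⌋ ⌈ suc ℓ /2⌉ A B (toℕ y))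
        ∼⟨ ∃-Fin⇔∃≤ ⟩
      (Σ ℕ λ Y → Y ≤ m × Midpoint ⌊ suc ℓ /2⌋ ⌈ suc ℓ /2⌉ A B Y)
        ∼⟨ ∃-Midpoint⇔<×≤ ⌊ suc ℓ /2⌋ ⌈ suc ℓ /2⌉ (val≤m b ρ) (s≤s z≤n) ⟩
      (A < B × B ≤ A + (⌊ suc ℓ /2⌋ + ⌈ suc ℓ /2⌉))
        ≡⟨ cong (λ k → A < B × B ≤ A + k) (⌊n/2⌋+⌈n/2⌉≡n (suc ℓ)) ⟩
      (A < B × B ≤ A + suc ℓ) ∎
      where
      open EquationalReasoning {k = equivalence}
      A = val a ρ
      B = val b ρ

    0<dist≤-sat-at : ∀ ℓ K → Enough∀ ⌊ suc ℓ /2⌋ K → Enough∀ ⌈ suc ℓ /2⌉ K →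
      ∀ {n} (a b : Term n) (ρ : Env m n) (y : Fin (suc m)) →
      Sat m (quantify ∀q K (0<dist≤ (suc ℓ) (suc K) a b)) (y ∷ ρ)
      ⇔ Midpoint ⌊ suc ℓ /2⌋ ⌈ suc ℓ /2⌉ (val a ρ) (val b ρ) (toℕ y)
    0<dist≤-sat-at ℓ K enough₁ enough₂ a b ρ y = begin
      Sat∀ (0<dist≤ (suc ℓ) (suc K) a b)
        ∼⟨ guard-∧ ∀q K _ _ (y ∷ ρ) (¬? (Y <? A) ×-dec (Y <? B)) (halfOpen-expresses K a b y ρ) ⟩
      ((¬ Y < A × Y < B) × Sat∀ (dist≤ ℓ₁ K (wk a) y′ ∧' dist≤ ℓ₂ K y′ (wk b)))
        ∼⟨ ⇔.refl ×-⇔ dist≤-∧ ℓ₁ ℓ₂ K (wk a) y′ (wk b) (y ∷ ρ) ⟩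
      ((¬ Y < A × Y < B) × Sat∀ (dist≤ ℓ₁ K (wk a) y′) × Sat∀ (dist≤ ℓ₂ K y′ (wk b)))
        ∼⟨ ⇔.refl ×-⇔ (dist≤-sat ℓ₁ K enough₁ (wk a) y′ (y ∷ ρ)
                       ×-⇔ dist≤-sat ℓ₂ K enough₂ y′ (wk b) (y ∷ ρ)) ⟩
      ((¬ Y < A × Y < B) × (Y ≤ A′ + ℓ₁ × B′ ≤ Y + ℓ₂))
        ≡⟨ cong₂ (λ A′ B′ → (¬ Y < A × Y < B) × (Y ≤ A′ + ℓ₁ × B′ ≤ Y + ℓ₂)) (val-wk a y ρ) (val-wk b y ρ) ⟩
      Midpoint ℓ₁ ℓ₂ A B Y ∎
      where
      open EquationalReasoning {k = equivalence}
      ℓ₁ = ⌊ suc ℓ /2⌋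
      ℓ₂ = ⌈ suc ℓ /2⌉
      A = val a ρ
      B = val b ρ
      Y = toℕ y
      y′ = var fzero
      A′ = val (wk a) (y ∷ ρ)
      B′ = val (wk b) (y ∷ ρ)
      Sat∀ : QF (suc _ ⊕ K) → Set
      Sat∀ M = Sat m (quantify ∀q K M) (y ∷ ρ)

-- Counting quantifiers

mutual
  Enough∀-suc : ∀ ℓ K → Enough∀ ℓ K → Enough∀ ℓ (suc K)
  Enough∀-suc zero    K       _             = tt
  Enough∀-suc (suc ℓ) (suc K) (enough₁ , enough₂) = Enough∃-suc _ K enough₁ , Enough∃-suc _ K enough₂

  Enough∃-suc : ∀ ℓ K → Enough∃ ℓ K → Enough∃ ℓ (suc K)
  Enough∃-suc zero    K       _             = tt
  Enough∃-suc (suc ℓ) (suc K) (enough₁ , enough₂) = Enough∀-suc _ K enough₁ , Enough∀-suc _ K enough₂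

mutual
  Enough∀-anti : ∀ K {ℓ ℓ′} → ℓ′ ≤ ℓ → Enough∀ ℓ K → Enough∀ ℓ′ K
  Enough∀-anti K       {ℓ′ = zero}  _         _ = tt
  Enough∀-anti zero    {suc ℓ} {suc ℓ′} _      ()
  Enough∀-anti (suc K) {suc ℓ} {suc ℓ′} (s≤s ℓ′≤ℓ) (enough₁ , enough₂) =
    Enough∃-anti K (⌊n/2⌋-mono ℓ′≤ℓ) enough₁ , Enough∃-anti K (⌈n/2⌉-mono ℓ′≤ℓ) enough₂

  Enough∃-anti : ∀ K {ℓ ℓ′} → ℓ′ ≤ ℓ → Enough∃ ℓ K → Enough∃ ℓ′ K
  Enough∃-anti K       {ℓ′ = zero}  _         _ = tt
  Enough∃-anti zero    {suc ℓ} {suc ℓ′} _      ()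
  Enough∃-anti (suc K) {suc ℓ} {suc ℓ′} ℓ′≤ℓ (enough₁ , enough₂) =
    Enough∀-anti K (⌊n/2⌋-mono ℓ′≤ℓ) enough₁ , Enough∀-anti K (⌈n/2⌉-mono ℓ′≤ℓ) enough₂

twice : ℕ → ℕ
twice zero    = zero
twice (suc j) = suc (suc (twice j))

data ParityView : ℕ → Set where
  odd  : ∀ j → ParityView (suc (twice j))
  even : ∀ j → ParityView (twice j)

parityView : ∀ n → ParityView n
parityView zero = even zero
parityView (suc n) with parityView n
... | odd j  = even (suc j)
... | even j = odd j

-- An innermost ∃ is useless: `0<dist≤ (suc ℓ) 1` would need `dist≤` of a positive
-- distance with no quantifier left.
mutual
  Enough∀-even⇒odd : ∀ j ℓ → Enough∀ ℓ (suc (suc (twice j))) → Enough∀ ℓ (suc (twice j))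
  Enough∀-even⇒odd j zero    _                    = tt
  Enough∀-even⇒odd j (suc ℓ) (enough₁ , enough₂) =
    Enough∃-odd⇒even j _ enough₁ , Enough∃-odd⇒even j _ enough₂

  Enough∃-odd⇒even : ∀ j ℓ → Enough∃ ℓ (suc (twice j)) → Enough∃ ℓ (twice j)
  Enough∃-odd⇒even j       zero    _                    = tt
  Enough∃-odd⇒even zero    (suc ℓ) (_ , ())
  Enough∃-odd⇒even (suc j) (suc ℓ) (enough₁ , enough₂) =
    Enough∀-even⇒odd j _ enough₁ , Enough∀-even⇒odd j _ enough₂

mutual
  Enough∀-qA : ∀ f n → 1 ≤ n → n ≤ f → Enough∀ n (suc (qA-fuel f n))
  Enough∀-qA (suc f) 1 _ _ = tt , tt
  Enough∀-qA (suc f) 2 _ _ = tt , (tt , (tt , tt))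
  Enough∀-qA (suc f) (suc (suc (suc k))) _ (s≤s n≤f) =
    Enough∃-anti _ (⌊n/2⌋≤⌈n/2⌉ (suc (suc k))) half , half
    where half = Enough∃-qE f _ (s≤s z≤n) (≤-trans (s≤s (⌊n/2⌋≤n (suc k))) n≤f)

  Enough∃-qE : ∀ f n → 1 ≤ n → n ≤ f → Enough∃ n (suc (qE-fuel f n))
  Enough∃-qE (suc f) 1 _ _ = tt , (tt , tt)
  Enough∃-qE (suc f) (suc (suc k)) _ (s≤s n≤f) =
    Enough∀-anti _ (⌊n/2⌋≤⌈n/2⌉ (suc (suc k))) half , half
    where half = Enough∀-qA f _ (s≤s z≤n) (≤-trans (⌊n/2⌋<n k) n≤f)

mutual
  Enough∃-qA : ∀ f n → 1 ≤ n → n ≤ f → Enough∃ n (suc (qA-fuel f n))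
  Enough∃-qA (suc f) 1 _ _ = tt , (tt , tt)
  Enough∃-qA (suc f) 2 _ _ = (tt , tt) , (tt , tt)
  Enough∃-qA (suc f) (suc (suc (suc k))) _ (s≤s n≤f) =
    Enough∀-anti _ (n≤1+n _) half , Enough∀-anti _ (s≤s (s≤s (⌊n/2⌋-mono (n≤1+n k)))) half
    where half = Enough∀-suc-qE f _ (s≤s z≤n) (≤-trans (s≤s (⌊n/2⌋≤n (suc k))) n≤f)

  Enough∀-suc-qE : ∀ f n → 1 ≤ n → n ≤ f → Enough∀ (suc n) (suc (qE-fuel f n))
  Enough∀-suc-qE (suc f) 1 _ _ = tt , (tt , (tt , tt))
  Enough∀-suc-qE (suc f) (suc (suc k)) _ (s≤s n≤f) =
    Enough∃-anti _ (⌊n/2⌋≤⌈n/2⌉ (suc (suc k))) half , half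
    where half = Enough∃-qA f _ (s≤s z≤n) (≤-trans (⌊n/2⌋<n k) n≤f)

⊓-closed : (P : ℕ → Set) {x y : ℕ} → P x → P y → P (x ⊓ y)
⊓-closed P {x} {y} Px Py with ⊓-sel x y
... | inj₁ x⊓y≡x = subst P (sym x⊓y≡x) Px
... | inj₂ x⊓y≡y = subst P (sym x⊓y≡y) Py

Enough∀-half-q* : ∀ k → Enough∀ ⌊ 3 + k /2⌋ (q* (3 + k))
Enough∀-half-q* k = ⊓-closed (Enough∀ ⌊ 3 + k /2⌋)
  (Enough∀-anti _ (n≤1+n _) (Enough∀-suc-qE (2 + k) _ (s≤s z≤n) (s≤s (⌊n/2⌋≤n (suc k)))))
  (Enough∀-anti _ (s≤s (⌊n/2⌋-mono (n≤1+n (suc k)))) (Enough∀-qA (2 + k) _ (s≤s z≤n) (s≤s (s≤s (⌊n/2⌋≤n k)))))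

⌊log₂⌊n/2⌋⌋+1 : ∀ n → 2 ≤ n → ⌊log₂ ⌊ n /2⌋ ⌋ + 1 ≡ ⌊log₂ n ⌋
⌊log₂⌊n/2⌋⌋+1 n 2≤n = trans (cong (_+ 1) (⌊log₂⌊n/2⌋⌋≡⌊log₂n⌋∸1 n)) (m∸n+n≡m (⌊log₂⌋-mono-≤ 2≤n))

mutual
  qA-fuel≤log : ∀ f n → 2 ≤ n → n ≤ f → qA-fuel f n ≤ ⌊log₂ (n ∸ 1) ⌋ + 2
  qA-fuel≤log f             1 (s≤s ()) _
  qA-fuel≤log (suc f)       2 _ _ = ≤-refl
  qA-fuel≤log (suc (suc f)) 3 _ _ = ≤-refl
  qA-fuel≤log (suc f) (suc (suc (suc (suc k)))) _ (s≤s n≤f) = begin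
    suc (qE-fuel f (suc ⌊ 2 + k /2⌋))
      ≤⟨ s≤s (qE-fuel≤log f _ (s≤s (s≤s z≤n)) (≤-trans (s≤s (s≤s (≤-trans (⌊n/2⌋≤n k) (n≤1+n _)))) n≤f)) ⟩
    suc (⌊log₂ ⌊ 2 + k /2⌋ ⌋ + 2)
      ≡⟨ cong suc (+-suc _ 1) ⟩
    2 + (⌊log₂ ⌊ 2 + k /2⌋ ⌋ + 1)
      ≡⟨ cong (2 +_) (⌊log₂⌊n/2⌋⌋+1 (2 + k) (s≤s (s≤s z≤n))) ⟩
    2 + ⌊log₂ (2 + k) ⌋
      ≤⟨ +-monoʳ-≤ 2 (⌊log₂⌋-mono-≤ (n≤1+n (2 + k))) ⟩
    2 + ⌊log₂ (3 + k) ⌋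
      ≡⟨ +-comm 2 _ ⟩
    ⌊log₂ (3 + k) ⌋ + 2 ∎
    where open ≤-Reasoning

  qE-fuel≤log : ∀ f n → 2 ≤ n → n ≤ f → qE-fuel f n ≤ ⌊log₂ (n ∸ 1) ⌋ + 2
  qE-fuel≤log f             1 (s≤s ()) _
  qE-fuel≤log (suc (suc f)) 2 _ _ = ≤-refl
  qE-fuel≤log (suc f) (suc (suc (suc k))) _ (s≤s n≤f) = begin
    suc (qA-fuel f (suc ⌊ 2 + k /2⌋))
      ≤⟨ s≤s (qA-fuel≤log f _ (s≤s (s≤s z≤n)) (≤-trans (⌊n/2⌋<n (suc k)) n≤f)) ⟩
    suc (⌊log₂ ⌊ 2 + k /2⌋ ⌋ + 2)
      ≡⟨ cong suc (+-suc _ 1) ⟩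
    2 + (⌊log₂ ⌊ 2 + k /2⌋ ⌋ + 1)
      ≡⟨ cong (2 +_) (⌊log₂⌊n/2⌋⌋+1 (2 + k) (s≤s (s≤s z≤n))) ⟩
    2 + ⌊log₂ (2 + k) ⌋
      ≡⟨ +-comm 2 _ ⟩
    ⌊log₂ (2 + k) ⌋ + 2 ∎
    where open ≤-Reasoning

q*≤log+2 : ∀ ℓ → 1 ≤ ℓ → q* ℓ ≤ ⌊log₂ ℓ ⌋ + 2
q*≤log+2 1 _ = s≤s z≤n
q*≤log+2 (suc (suc k)) _ = begin
  q*∀ (2 + k) ⊓ q*∃ (2 + k)  ≤⟨ m⊓n≤m _ _ ⟩
  q*∀ (2 + k)                ≤⟨ qA-fuel≤log (2 + k) (2 + k) (s≤s (s≤s z≤n)) ≤-refl ⟩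
  ⌊log₂ (1 + k) ⌋ + 2        ≤⟨ +-monoˡ-≤ 2 (⌊log₂⌋-mono-≤ (n≤1+n (suc k))) ⟩
  ⌊log₂ (2 + k) ⌋ + 2        ∎
  where open ≤-Reasoning

-- The length formula

-- Under an ∃-block of K + 1 quantifiers, `farClose P Q K a c b` says c > a + P and b ≤ c + Q:
-- the block's first variable belongs to the negated `dist≤`, which the other conjunct skips
-- (hence the weakenings).  `closeFar` swaps the roles.
farClose closeFar : ℕ → ℕ → (K : ℕ) → ∀ {n} → Term n → Term n → Term n → QF (n ⊕ suc K)
farClose P Q K a c b = (¬' dist≤ P (suc K) a c) ∧' dist≤ Q K (wk c) (wk b)
closeFar P Q K a c b = dist≤ P K (wk a) (wk c) ∧' (¬' dist≤ Q (suc K) c b)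

lengthIs : ℕ → ℕ → (K : ℕ) → ∀ {n} → QF (n ⊕ suc (suc K))
lengthIs P Q K =
  (¬' (cmin <[ suc K ] var fzero))
  ∨' (farClose P Q K cmin (var fzero) cmax ∨' closeFar P Q K cmin (var fzero) cmax)

module _ {m : ℕ} where

  farClose-sat : ∀ P Q K → Enough∀ (suc P) K → Enough∀ Q K → ∀ {n} (a c b : Term n) (ρ : Env m n) →
    Sat m (quantify ∃q (suc K) (farClose (suc P) Q K a c b)) ρ
    ⇔ (¬ val c ρ ≤ val a ρ + suc P × val b ρ ≤ val c ρ + Q)
  farClose-sat P Q (suc K) enoughP enoughQ a c b ρ = begin
    (Σ (Fin (suc m)) λ u → Sat∀ u (farClose (suc P) Q (suc K) a c b))
      ∼⟨ Σ.congˡ (λ {u} → split u) ⟩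
    (Σ (Fin (suc m)) λ u → Sat∀ u (¬' dist≤ (suc P) (suc (suc K)) a c) × Sat∀ u (dist≤ Q (suc K) (wk c) (wk b)))
      ∼⟨ Σ-×-const close ⟩
    (Sat m (quantify ∃q (suc (suc K)) (¬' dist≤ (suc P) (suc (suc K)) a c)) ρ × val b ρ ≤ val c ρ + Q)
      ∼⟨ quantify-¬ ∀q (suc (suc K)) _ ρ ×-⇔ ⇔.refl ⟩
    (¬ Sat m (quantify ∀q (suc (suc K)) (dist≤ (suc P) (suc (suc K)) a c)) ρ × val b ρ ≤ val c ρ + Q)
      ∼⟨ ¬-cong-⇔ (dist≤-sat (suc P) (suc (suc K)) (Enough∀-suc _ _ enoughP) a c ρ) ×-⇔ ⇔.refl ⟩
    (¬ val c ρ ≤ val a ρ + suc P × val b ρ ≤ val c ρ + Q) ∎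
    where
    open EquationalReasoning {k = equivalence}
    Sat∀ : Fin (suc m) → QF (suc _ ⊕ suc K) → Set
    Sat∀ u M = Sat m (quantify ∀q (suc K) M) (u ∷ ρ)

    close : (u : Fin (suc m)) → Sat∀ u (dist≤ Q (suc K) (wk c) (wk b)) ⇔ val b ρ ≤ val c ρ + Q
    close u = ⇔.trans (dist≤-sat Q (suc K) enoughQ (wk c) (wk b) (u ∷ ρ))
                      (≡⇒ (cong₂ (λ C B → B ≤ C + Q) (val-wk c u ρ) (val-wk b u ρ)))

    split : (u : Fin (suc m)) → Sat∀ u (farClose (suc P) Q (suc K) a c b)
            ⇔ (Sat∀ u (¬' dist≤ (suc P) (suc (suc K)) a c) × Sat∀ u (dist≤ Q (suc K) (wk c) (wk b)))
    split u with (val a ρ <? toℕ u) ×-dec (toℕ u <? val c ρ)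
    ... | no ¬a<u<c = quantify-∧ ∀q (suc K) _ _ (u ∷ ρ)
      (inj₁ (inj₂ (λ vs far → far (dist≤-true-outside P (suc K) a c ρ u ¬a<u<c vs))))
    ... | yes a<u<c = quantify∀-∧ K _ _ (u ∷ ρ) oneConstant
      where
      oneConstant : (z : Fin (suc m)) → Constant K (¬' dist≤ (suc P) (suc (suc K)) a c) (z ∷ u ∷ ρ)
                                       ⊎ Constant K (dist≤ Q (suc K) (wk c) (wk b)) (z ∷ u ∷ ρ)
      oneConstant z with ¬? (toℕ z <? val a ρ) ×-dec (toℕ z <? val c ρ)
      ... | no ¬a≤z<c = inj₁ (inj₁ (dist≤-false-after-split P K a c ρ u z a<u<c ¬a≤z<c))
      ... | yes (_ , z<c) = inj₂ (dist≤-constant-outside Q K (wk c) (wk b) (u ∷ ρ) z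
                                   (λ (c<z , _) → <-asym z<c (subst (_< toℕ z) (val-wk c u ρ) c<z)))

  closeFar-sat : ∀ P Q K → Enough∀ P K → Enough∀ (suc Q) K → ∀ {n} (a c b : Term n) (ρ : Env m n) →
    Sat m (quantify ∃q (suc K) (closeFar P (suc Q) K a c b)) ρ
    ⇔ (val c ρ ≤ val a ρ + P × ¬ val b ρ ≤ val c ρ + suc Q)
  closeFar-sat P Q (suc K) enoughP enoughQ a c b ρ = begin
    (Σ (Fin (suc m)) λ u → Sat∀ u (closeFar P (suc Q) (suc K) a c b))
      ∼⟨ Σ.congˡ (λ {u} → split u) ⟩
    (Σ (Fin (suc m)) λ u → Sat∀ u (dist≤ P (suc K) (wk a) (wk c)) × Sat∀ u (¬' dist≤ (suc Q) (suc (suc K)) c b))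
      ∼⟨ Σ-const-× close ⟩
    (val c ρ ≤ val a ρ + P × Sat m (quantify ∃q (suc (suc K)) (¬' dist≤ (suc Q) (suc (suc K)) c b)) ρ)
      ∼⟨ ⇔.refl ×-⇔ quantify-¬ ∀q (suc (suc K)) _ ρ ⟩
    (val c ρ ≤ val a ρ + P × ¬ Sat m (quantify ∀q (suc (suc K)) (dist≤ (suc Q) (suc (suc K)) c b)) ρ)
      ∼⟨ ⇔.refl ×-⇔ ¬-cong-⇔ (dist≤-sat (suc Q) (suc (suc K)) (Enough∀-suc _ _ enoughQ) c b ρ) ⟩
    (val c ρ ≤ val a ρ + P × ¬ val b ρ ≤ val c ρ + suc Q) ∎
    where
    open EquationalReasoning {k = equivalence}
    Sat∀ : Fin (suc m) → QF (suc _ ⊕ suc K) → Set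
    Sat∀ u M = Sat m (quantify ∀q (suc K) M) (u ∷ ρ)

    close : (u : Fin (suc m)) → Sat∀ u (dist≤ P (suc K) (wk a) (wk c)) ⇔ val c ρ ≤ val a ρ + P
    close u = ⇔.trans (dist≤-sat P (suc K) enoughP (wk a) (wk c) (u ∷ ρ))
                      (≡⇒ (cong₂ (λ A C → C ≤ A + P) (val-wk a u ρ) (val-wk c u ρ)))

    split : (u : Fin (suc m)) → Sat∀ u (closeFar P (suc Q) (suc K) a c b)
            ⇔ (Sat∀ u (dist≤ P (suc K) (wk a) (wk c)) × Sat∀ u (¬' dist≤ (suc Q) (suc (suc K)) c b))
    split u with (val c ρ <? toℕ u) ×-dec (toℕ u <? val b ρ)
    ... | no ¬c<u<b = quantify-∧ ∀q (suc K) _ _ (u ∷ ρ)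
      (inj₂ (inj₂ (λ vs far → far (dist≤-true-outside Q (suc K) c b ρ u ¬c<u<b vs))))
    ... | yes c<u<b = quantify∀-∧ K _ _ (u ∷ ρ) oneConstant
      where
      oneConstant : (z : Fin (suc m)) → Constant K (dist≤ P (suc K) (wk a) (wk c)) (z ∷ u ∷ ρ)
                                       ⊎ Constant K (¬' dist≤ (suc Q) (suc (suc K)) c b) (z ∷ u ∷ ρ)
      oneConstant z with ¬? (toℕ z <? val c ρ) ×-dec (toℕ z <? val b ρ)
      ... | no ¬c≤z<b = inj₂ (inj₁ (dist≤-false-after-split Q K c b ρ u z c<u<b ¬c≤z<b))
      ... | yes (c≤z , _) = inj₁ (dist≤-constant-outside P K (wk a) (wk c) (u ∷ ρ) z
                                   (λ (_ , z<c) → c≤z (subst (toℕ z <_) (val-wk c u ρ) z<c)))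

  farClose-∨-closeFar : ∀ P Q K {n} (a c b : Term n) (ρ : Env m n) →
    Sat m (quantify ∃q (suc K) (farClose (suc P) (suc Q) K a c b ∨' closeFar (suc P) (suc Q) K a c b)) ρ
    ⇔ (Sat m (quantify ∃q (suc K) (farClose (suc P) (suc Q) K a c b)) ρ
       ⊎ Sat m (quantify ∃q (suc K) (closeFar (suc P) (suc Q) K a c b)) ρ)
  farClose-∨-closeFar P Q K a c b ρ = quantify∃-∨ K _ _ ρ oneFalse
    where
    oneFalse : (u : Fin (suc m)) → Constant K (farClose (suc P) (suc Q) K a c b) (u ∷ ρ)
                                  ⊎ Constant K (closeFar (suc P) (suc Q) K a c b) (u ∷ ρ)
    oneFalse u with (val a ρ <? toℕ u) ×-dec (toℕ u <? val c ρ)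
    ... | no ¬a<u<c     = inj₁ (inj₂ (λ vs (far , _) → far (dist≤-true-outside P K a c ρ u ¬a<u<c vs)))
    ... | yes (_ , u<c) = inj₂ (inj₂ (λ vs (_ , far) →
                            far (dist≤-true-outside Q K c b ρ u (λ (c<u , _) → <-asym u<c c<u) vs)))

  lengthIs-sat : ∀ P Q K → Enough∀ (suc P) K → Enough∀ (suc Q) K → 1 ≤ m → ∀ {n} (ρ : Env m n) →
    Sat m (quantify ∀q (suc (suc K)) (lengthIs (suc P) (suc Q) K)) ρ ⇔ m ≡ suc (suc P + suc Q)
  lengthIs-sat P Q K enoughP enoughQ 1≤m ρ = begin
    ((x : Fin (suc m)) → Sat m (quantify ∃q (suc K) (lengthIs (suc P) (suc Q) K)) (x ∷ ρ))
      ∼⟨ ∀-cong-⇔ threshold ⟩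
    ((x : Fin (suc m)) → Threshold (suc P) (suc Q) m (toℕ x))
      ∼⟨ ∀-Fin⇔∀≤ ⟩
    ((X : ℕ) → X ≤ m → Threshold (suc P) (suc Q) m X)
      ∼⟨ ∀-Threshold⇔≡ (suc P) (suc Q) (s≤s z≤n) 1≤m ⟩
    m ≡ suc (suc P + suc Q) ∎
    where
    open EquationalReasoning {k = equivalence}

    threshold : (x : Fin (suc m)) →
      Sat m (quantify ∃q (suc K) (lengthIs (suc P) (suc Q) K)) (x ∷ ρ) ⇔ Threshold (suc P) (suc Q) m (toℕ x)
    threshold x = begin
      Sat∃ (lengthIs (suc P) (suc Q) K)
        ∼⟨ guard-∨ ∃q (suc K) _ _ (x ∷ ρ) (¬? (0 <? X))
                   (λ vs → ¬-cong-⇔ (<-expresses (suc K) cmin x′ (x ∷ ρ) vs)) ⟩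
      (¬ 0 < X ⊎ Sat∃ (farClose (suc P) (suc Q) K cmin x′ cmax ∨' closeFar (suc P) (suc Q) K cmin x′ cmax))
        ∼⟨ ⇔.refl ⊎-⇔ farClose-∨-closeFar P Q K cmin x′ cmax (x ∷ ρ) ⟩
      (¬ 0 < X ⊎ Sat∃ (farClose (suc P) (suc Q) K cmin x′ cmax) ⊎ Sat∃ (closeFar (suc P) (suc Q) K cmin x′ cmax))
        ∼⟨ ⇔.refl ⊎-⇔ (farClose-sat P (suc Q) K enoughP enoughQ cmin x′ cmax (x ∷ ρ)
                       ⊎-⇔ closeFar-sat (suc P) Q K enoughP enoughQ cmin x′ cmax (x ∷ ρ)) ⟩
      Threshold (suc P) (suc Q) (toℕ (fromℕ m)) X
        ≡⟨ cong (λ M → Threshold (suc P) (suc Q) M X) (Fin.toℕ-fromℕ m) ⟩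
      Threshold (suc P) (suc Q) m X ∎
      where
      X = toℕ x
      x′ = var fzero
      Sat∃ : QF (suc _ ⊕ suc K) → Set
      Sat∃ N = Sat m (quantify ∃q (suc K) N) (x ∷ ρ)

-- The defining sentences

WellShaped : ℕ → Sentence → Set
WellShaped K φ = Alternating (prefix φ) × EndsWith∀ (prefix φ) × length (prefix φ) ≡ K

Defines : ℕ → Sentence → Set
Defines ℓ φ = (m : ℕ) → 1 ≤ m → m ⊨ φ ⇔ m ≡ ℓ

wellShaped : ∀ φ s K → prefix φ ≡ alternation s K → EndsWith∀ (alternation s K) → WellShaped K φ
wellShaped φ s K prefix≡ ends∀ =
  subst (λ qs → Alternating qs × EndsWith∀ qs × length qs ≡ K) (sym prefix≡)
        (alternation-Alternating s K , ends∀ , length-alternation s K)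

EndsWith∀-odd : ∀ j → EndsWith∀ (alternation ∀q (suc (twice j)))
EndsWith∀-odd zero    = refl
EndsWith∀-odd (suc j) = EndsWith∀-odd j

lengthIs-sentence : ∀ P Q K → Enough∀ (suc P) K → Enough∀ (suc Q) K →
  Σ Sentence λ φ → WellShaped (K + 2) φ × Defines (suc (suc P + suc Q)) φ
lengthIs-sentence P Q K enoughP enoughQ with parityView K
... | odd j = φ , subst (λ L → WellShaped L φ) (+-comm 2 K) shape , defines
  where
  φ = quantify ∀q (2 + K) (lengthIs (suc P) (suc Q) K)
  shape : WellShaped (2 + K) φ
  shape = wellShaped φ ∀q (2 + K) (prefix-quantify ∀q (2 + K) (lengthIs (suc P) (suc Q) K))
                     (EndsWith∀-odd (suc j))
  defines : Defines (suc (suc P + suc Q)) φ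
  defines m 1≤m = lengthIs-sat P Q K enoughP enoughQ 1≤m []
-- A vacuous leading ∃ makes the prefix end with ∀; the budget's innermost ∃ is useless anyway.
... | even (suc j) = φ , subst (λ L → WellShaped L φ) (+-comm 2 K) shape , defines
  where
  K′ = suc (twice j)
  φ = ∃' (quantify ∀q (2 + K′) (lengthIs (suc P) (suc Q) K′))
  shape : WellShaped (2 + K) φ
  shape = wellShaped φ ∃q (2 + K) (cong (∃q ∷_) (prefix-quantify ∀q (2 + K′) (lengthIs (suc P) (suc Q) K′)))
                     (EndsWith∀-odd (suc j))
  defines : Defines (suc (suc P + suc Q)) φ
  defines m 1≤m = mk⇔ (λ (x , sat) → to (sat⇔ x) sat) (λ m≡ → fzero , from (sat⇔ fzero) m≡)
    where
    sat⇔ = λ x → lengthIs-sat P Q K′ (Enough∀-even⇒odd j _ enoughP) (Enough∀-even⇒odd j _ enoughQ)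
                              1≤m (x ∷ [])

length1-sentence : Σ Sentence λ φ → WellShaped 3 φ × Defines 1 φ
length1-sentence = φ , wellShaped φ ∀q 3 refl refl , defines
  where
  φ : Sentence
  φ = quantify ∀q 3 (dist≤ 1 3 cmin cmax)
  defines : Defines 1 φ
  defines m 1≤m = begin
    m ⊨ φ                  ∼⟨ dist≤-sat 1 3 (tt , tt) cmin cmax [] ⟩
    toℕ (fromℕ m) ≤ 0 + 1  ≡⟨ cong (_≤ 1) (Fin.toℕ-fromℕ m) ⟩
    m ≤ 1                  ∼⟨ mk⇔ (λ m≤1 → ≤-antisym m≤1 1≤m) ≤-reflexive ⟩
    m ≡ 1                  ∎
    where open EquationalReasoning {k = equivalence}

length2-sentence : Σ Sentence λ φ → WellShaped 4 φ × Defines 2 φ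
length2-sentence = φ , wellShaped φ ∃q 4 refl refl , defines
  where
  between : QF (1 ⊕ 3)
  between = (cmin <[ 3 ] var fzero) ∧' (var fzero <[ 3 ] cmax)
  φ : Sentence
  φ = quantify ∃q 4 (between ∧' dist≤ 2 3 cmin cmax)
  defines : Defines 2 φ
  defines m 1≤m = begin
    m ⊨ φ
      ∼⟨ Σ.congˡ (λ {u} → guard-∧ ∀q 3 between (dist≤ 2 3 cmin cmax) (u ∷ [])
                                   ((0 <? toℕ u) ×-dec (toℕ u <? M)) (between-expresses 3 cmin cmax u [])) ⟩
    (Σ (Fin (suc m)) λ u → (0 < toℕ u × toℕ u < M) × Sat m (quantify ∀q 3 (dist≤ 2 3 cmin cmax)) (u ∷ []))
      ∼⟨ Σ-×-const (λ u → dist≤-sat 2 3 (tt , tt , tt , tt) cmin cmax (u ∷ [])) ⟩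
    ((Σ (Fin (suc m)) λ u → 0 < toℕ u × toℕ u < M) × M ≤ 2)
      ≡⟨ cong (λ M → (Σ (Fin (suc m)) λ u → 0 < toℕ u × toℕ u < M) × M ≤ 2) (Fin.toℕ-fromℕ m) ⟩
    ((Σ (Fin (suc m)) λ u → 0 < toℕ u × toℕ u < m) × m ≤ 2)
      ∼⟨ mk⇔ (λ ((u , 0<u , u<m) , m≤2) → ≤-antisym m≤2 (≤-trans (s≤s 0<u) u<m))
             (λ { refl → (fsuc fzero , z<s , s<s z<s) , ≤-refl }) ⟩
    m ≡ 2 ∎
    where
    open EquationalReasoning {k = equivalence}
    M = toℕ (fromℕ m)

characterisation : ∀ ℓ → 1 ≤ ℓ → Σ Sentence λ φ → WellShaped (q* ℓ + 2) φ × Defines ℓ φ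
characterisation 1 _ = length1-sentence
characterisation 2 _ = length2-sentence
characterisation (suc (suc (suc k))) _
  with lengthIs-sentence ⌊ 1 + k /2⌋ ⌊ k /2⌋ (q* (3 + k)) (Enough∀-half-q* k)
         (Enough∀-anti _ (⌊n/2⌋-mono (n≤1+n (2 + k))) (Enough∀-half-q* k))
... | φ , shape , defines = φ , shape , subst (λ ℓ → Defines ℓ φ) halves defines
  where
  halves : suc (suc ⌊ 1 + k /2⌋ + suc ⌊ k /2⌋) ≡ 3 + k
  halves = cong (2 +_) (trans (+-suc ⌈ k /2⌉ ⌊ k /2⌋)
                              (cong suc (trans (+-comm ⌈ k /2⌉ ⌊ k /2⌋) (⌊n/2⌋+⌈n/2⌉≡n k))))

theorem4p7 : (ℓ : ℕ) → 1 ≤ ℓ →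
    Σ Sentence λ φ →
      Alternating (prefix φ) × EndsWith∀ (prefix φ)
      × length (prefix φ) ≡ q* ℓ + 2
      × length (prefix φ) ≤ ⌊log₂ ℓ ⌋ + 4
      × ℓ ⊨ φ
      × ((m : ℕ) → 1 ≤ m → m ≢ ℓ → ¬ (m ⊨ φ))
theorem4p7 ℓ 1≤ℓ with characterisation ℓ 1≤ℓ
... | φ , (alternates , ends∀ , length≡) , defines =
  φ , alternates , ends∀ , length≡ ,
  subst (_≤ ⌊log₂ ℓ ⌋ + 4) (sym length≡) (subst (q* ℓ + 2 ≤_) (+-assoc _ 2 2) (+-monoˡ-≤ 2 (q*≤log+2 ℓ 1≤ℓ))) ,
  from (defines ℓ 1≤ℓ) refl ,
  λ m 1≤m m≢ℓ m⊨φ → m≢ℓ (to (defines m 1≤m) m⊨φ)
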